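{- Let $T$ be a tree and $F$ a minimal fort of $T$. Then there do not exist distinct vertices $a,b,c\in F$ and a vertex $u\in V(T)$ with $a,b,c\in N(u)\cup\{u\}$; that is, $|(N(u)\cup\{u\})\cap F|\le 2$ for every $u\in V(T)$.
   Context: $N(u)$ denotes the set of neighbors of $u$ (not including $u$). A fort of a graph is a nonempty set $F$ of vertices such that every vertex not in $F$ is adjacent to either zero or at least two vertices of $F$; it is minimal if no proper subset is a fort. -}

module Defs where

open import Data.Nat using (ℕ; zero; suc; _≤_; _<_; _+_)
open import Data.Fin using (Fin)
open import Data.Bool using (Bool; true; false; _∧_; T)
open import Data.Fin.Subset using (Subset; _∈_; _∉_; _⊂_; Nonempty)
open import Data.Vec using (Vec; lookup)
open import Data.List using (List; []; _∷_; length; filter)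
open import Data.List.Base using (allFin) renaming (map to lmap)
open import Data.List.Relation.Unary.AllPairs using (AllPairs)
open import Data.Product using (Σ; _×_; ∃; _,_)
open import Data.Sum using (_⊎_)
open import Relation.Binary.PropositionalEquality using (_≡_; _≢_)
open import Relation.Nullary using (¬_)
open import Data.Bool.Properties using (T?)

record Graph (n : ℕ) : Set where
  field
    adj   : Fin n → Fin n → Bool
    sym   : ∀ u v → adj u v ≡ adj v u
    irref : ∀ u → adj u u ≡ false
open Graph public

Adj : ∀ {n} → Graph n → Fin n → Fin n → Set
Adj G u v = T (adj G u v)

data Walk {n} (G : Graph n) : Fin n → Fin n → Set where
  here : ∀ u → Walk G u u
  step : ∀ {u v w} → Adj G u v → Walk G v w → Walk G u w

Connected : ∀ {n} → Graph n → Set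
Connected G = ∀ u v → Walk G u v

verts : ∀ {n} {G : Graph n} {u v} → Walk G u v → List (Fin n)
verts (here u) = u ∷ []
verts (step {u} _ w) = u ∷ verts w

HasCycle : ∀ {n} → Graph n → Set
HasCycle {n} G = Σ (Fin n) λ u → Σ (Fin n) λ v → Σ (Walk G u v) λ w →
  AllPairs _≢_ (verts w) × 3 ≤ length (verts w) × Adj G v u

IsTree : ∀ {n} → Graph n → Set
IsTree {n} G = (0 < n) × Connected G × ¬ HasCycle G

nbrsIn : ∀ {n} → Graph n → Subset n → Fin n → ℕ
nbrsIn {n} G F v = length (filter (λ w → T? (adj G v w ∧ lookup F w)) (allFin n))

IsFort : ∀ {n} → Graph n → Subset n → Set
IsFort G F = Nonempty F × (∀ v → v ∉ F → nbrsIn G F v ≢ 1)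

IsMinimalFort : ∀ {n} → Graph n → Subset n → Set
IsMinimalFort G F = IsFort G F × (∀ F′ → F′ ⊂ F → ¬ IsFort G F′)

InClosedNbhd : ∀ {n} → Graph n → Fin n → Fin n → Set
InClosedNbhd G u a = (a ≡ u) ⊎ Adj G u a

{-# OPTIONS --safe #-}
-- Fix u and two distinct neighbours x, y of u lying in the minimal fort F. Since T is a
-- tree, removing u splits T into branches, one through each neighbour of u. The vertices
-- of F in the branches of x and y already form a fort: u sees x and y in it, a vertex of
-- another branch sees none of it, and a vertex of these two branches outside F sees the
-- same F-vertices as before (its only possible neighbour outside the branches is u, and
-- then it is x or y, which lie in F). By minimality this fort is all of F, so F contains
-- neither u nor a neighbour of u other than x and y.
module Submission where

open import Defs hiding (sym)
open import Level using (0ℓ)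
open import Data.Nat using (_≤_; s≤s; z≤n)
open import Data.Fin using (Fin; _≟_)
open import Data.Fin.Subset using (Subset; _∈_; _∉_)
open import Data.Bool using (T; _∧_)
open import Data.Bool.Properties using (T?; T-≡; T-∧)
open import Data.Empty using (⊥; ⊥-elim)
open import Data.Product using (Σ; _×_; _,_; proj₁; proj₂)
open import Data.Sum using (_⊎_; inj₁; inj₂; [_,_])
open import Data.List using (List; []; _∷_; length; allFin)
open import Data.List.Properties using (filter-≐; filter-none)
import Data.List.Membership.Propositional as List
open import Data.List.Membership.Propositional.Properties using (∈-filter⁺; ∈-allFin)
open import Data.List.Relation.Unary.All as All using (All; []; _∷_)
open import Data.List.Relation.Unary.All.Properties.Core using (¬Any⇒All¬)
open import Data.List.Relation.Unary.Any using (here; there; any?)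
open import Data.List.Relation.Unary.AllPairs using (AllPairs; []; _∷_)
open import Data.Vec using (lookup; tabulate)
open import Data.Vec.Properties using (lookup∘tabulate; lookup⇒[]=; []=⇒lookup)
open import Function using (_∘_)
open import Function.Bundles using (Equivalence)
open import Relation.Binary.PropositionalEquality
  using (_≡_; refl; _≢_; sym; trans; subst; cong; ≢-sym)
open import Relation.Nullary using (¬_; yes; no)
open import Relation.Nullary.Decidable
  using (⌊_⌋; decidable-stable; toWitness; fromWitness; ¬?; _×-dec_; _⊎-dec_)
open import Relation.Unary using (Pred; Decidable)

open Equivalence using (to; from)

module _ {n} {F : Subset n} {w : Fin n} where

  ∈⇒T-lookup : w ∈ F → T (lookup F w)
  ∈⇒T-lookup = from T-≡ ∘ []=⇒lookup

  T-lookup⇒∈ : T (lookup F w) → w ∈ F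
  T-lookup⇒∈ = lookup⇒[]= w F ∘ to T-≡

restrict : ∀ {n} {P : Pred (Fin n) 0ℓ} → Subset n → Decidable P → Subset n
restrict F P? = tabulate (λ w → lookup F w ∧ ⌊ P? w ⌋)

module _ {n} {F : Subset n} {P : Pred (Fin n) 0ℓ} (P? : Decidable P) {w : Fin n} where

  ∈-restrict⁺ : w ∈ F → P w → w ∈ restrict F P?
  ∈-restrict⁺ w∈F Pw = T-lookup⇒∈ (subst T (sym (lookup∘tabulate _ w))
    (from T-∧ (∈⇒T-lookup w∈F , fromWitness {a? = P? w} Pw)))

  ∈-restrict⁻ : w ∈ restrict F P? → w ∈ F × P w
  ∈-restrict⁻ w∈F′ with to T-∧ (subst T (lookup∘tabulate _ w) (∈⇒T-lookup w∈F′))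
  ... | F[w] , P?[w] = T-lookup⇒∈ F[w] , toWitness {a? = P? w} P?[w]

length≢1 : ∀ {A : Set} {x y : A} {xs : List A} →
  x List.∈ xs → y List.∈ xs → x ≢ y → length xs ≢ 1
length≢1 {xs = _ ∷ []}    (here refl) (here refl) x≢y _ = x≢y refl
length≢1 {xs = _ ∷ []}    (there ())  _           _   _
length≢1 {xs = _ ∷ []}    (here _)    (there ())  _   _
length≢1 {xs = _ ∷ _ ∷ _} _           _           _   ()

module _ {n} (G : Graph n) where

  Adj-sym : ∀ {v w} → Adj G v w → Adj G w v
  Adj-sym {v} {w} = subst T (Graph.sym G v w)

  Adj⇒≢ : ∀ {v w} → Adj G v w → v ≢ w
  Adj⇒≢ {v} vw refl = subst T (irref G v) vw

  InClosedNbhd⇒Adj : ∀ {u w} → InClosedNbhd G u w → w ≢ u → Adj G u w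
  InClosedNbhd⇒Adj (inj₁ w≡u) w≢u = ⊥-elim (w≢u w≡u)
  InClosedNbhd⇒Adj (inj₂ uw)  _   = uw

  module _ {v : Fin n} where

    T-adj∧lookup : ∀ {F w} → Adj G v w → w ∈ F → T (adj G v w ∧ lookup F w)
    T-adj∧lookup vw w∈F = from T-∧ (vw , ∈⇒T-lookup w∈F)

    nbrsIn≢1 : ∀ {F x y} → Adj G v x → Adj G v y → x ∈ F → y ∈ F → x ≢ y →
      nbrsIn G F v ≢ 1
    nbrsIn≢1 vx vy x∈F y∈F = length≢1
      (∈-filter⁺ _ (∈-allFin _) (T-adj∧lookup vx x∈F))
      (∈-filter⁺ _ (∈-allFin _) (T-adj∧lookup vy y∈F))

    nbrsIn-zero : ∀ {F} → (∀ {w} → Adj G v w → w ∉ F) → nbrsIn G F v ≡ 0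
    nbrsIn-zero {F} no-nbr = cong length
      (filter-none (λ w → T? (adj G v w ∧ lookup F w)) {allFin n} (All.tabulate λ _ vw∧w∈F →
        let vw , w∈F = to T-∧ vw∧w∈F in no-nbr vw (T-lookup⇒∈ w∈F)))

    nbrsIn-cong : ∀ {F F′} → (∀ {w} → Adj G v w → w ∈ F → w ∈ F′) →
      (∀ {w} → Adj G v w → w ∈ F′ → w ∈ F) → nbrsIn G F v ≡ nbrsIn G F′ v
    nbrsIn-cong F⊆F′ F′⊆F = cong length (filter-≐ _ _ (transfer F⊆F′ , transfer F′⊆F) (allFin n))
      where
      transfer : ∀ {A B : Subset n} → (∀ {w} → Adj G v w → w ∈ A → w ∈ B) →
        ∀ {w} → T (adj G v w ∧ lookup A w) → T (adj G v w ∧ lookup B w)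
      transfer A⊆B vw∧w∈A = let vw , w∈A = to T-∧ vw∧w∈A in
        T-adj∧lookup vw (A⊆B vw (T-lookup⇒∈ w∈A))

restrict-isFort : ∀ {n} (G : Graph n) {F : Subset n} {P : Pred (Fin n) 0ℓ} (P? : Decidable P)
  {u x y : Fin n} → IsFort G F → ¬ P u →
  (∀ {v w} → P v → w ≢ u → Adj G v w → P w) →
  (∀ {w} → Adj G u w → P w → w ∈ F) →
  Adj G u x → Adj G u y → x ≢ y → P x → P y → IsFort G (restrict F P?)
restrict-isFort G {F} P? {u} (_ , fort) ¬Pu P-closed nbrs⊆F ux uy x≢y Px Py =
  (_ , x∈F′) , outside
  where
  x∈F′ = ∈-restrict⁺ P? (nbrs⊆F ux Px) Px
  y∈F′ = ∈-restrict⁺ P? (nbrs⊆F uy Py) Py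

  outside : ∀ v → v ∉ restrict F P? → nbrsIn G (restrict F P?) v ≢ 1
  outside v v∉F′ with v ≟ u | P? v
  ... | yes refl | _      = nbrsIn≢1 G ux uy x∈F′ y∈F′ x≢y
  ... | no v≢u   | no ¬Pv = subst (_≢ 1) (sym (nbrsIn-zero G {F = restrict F P?} λ vw w∈F′ →
    ¬Pv (P-closed (proj₂ (∈-restrict⁻ {F = F} P? w∈F′)) v≢u (Adj-sym G vw)))) λ ()
  ... | no v≢u   | yes Pv =
    subst (_≢ 1) (nbrsIn-cong G F⊆F′ λ _ → proj₁ ∘ ∈-restrict⁻ {F = F} P?) (fort v v∉F)
    where
    v∉F : v ∉ F
    v∉F v∈F = v∉F′ (∈-restrict⁺ P? v∈F Pv)

    F⊆F′ : ∀ {w} → Adj G v w → w ∈ F → w ∈ restrict F P?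
    F⊆F′ {w} vw w∈F with w ≟ u
    ... | yes refl = ⊥-elim (v∉F (nbrs⊆F (Adj-sym G vw) Pv))
    ... | no w≢u   = ∈-restrict⁺ P? w∈F (P-closed Pv w≢u vw)

module _ {n} {G : Graph n} (P : Pred (Fin n) 0ℓ) where

  PathWithin : Fin n → Fin n → Set
  PathWithin a b = Σ (Walk G a b) λ W → AllPairs _≢_ (verts W) × All P (verts W)

  path-suffix : ∀ {a v b} (W : Walk G v b) → a List.∈ verts W →
    AllPairs _≢_ (verts W) → All P (verts W) → PathWithin a b
  path-suffix W@(here _)   (here refl) W-distinct W⊆P = W , W-distinct , W⊆P
  path-suffix W@(step _ _) (here refl) W-distinct W⊆P = W , W-distinct , W⊆P
  path-suffix (here _)     (there ())
  path-suffix (step _ W)   (there a∈W) (_ ∷ W-distinct) (_ ∷ W⊆P) =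
    path-suffix W a∈W W-distinct W⊆P

  walk⇒path : ∀ {a b} (W : Walk G a b) → All P (verts W) → PathWithin a b
  walk⇒path (here a) a⊆P = here a , [] ∷ [] , a⊆P
  walk⇒path {a} (step e W) (Pa ∷ W⊆P) with walk⇒path W W⊆P
  ... | W′ , W′-distinct , W′⊆P with any? (a ≟_) (verts W′)
  ...   | yes a∈W′ = path-suffix W′ a∈W′ W′-distinct W′⊆P
  ...   | no a∉W′  = step e W′ , ¬Any⇒All¬ (verts W′) a∉W′ ∷ W′-distinct , Pa ∷ W′⊆P

1≤length-verts : ∀ {n} {G : Graph n} {a b} (W : Walk G a b) → 1 ≤ length (verts W)
1≤length-verts (here _)   = s≤s z≤n
1≤length-verts (step _ _) = s≤s z≤n

module Avoiding {n} (G : Graph n) (u : Fin n) where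

  data WalkAvoiding : Fin n → Fin n → Set where
    stop : ∀ {a} → a ≢ u → WalkAvoiding a a
    move : ∀ {a b c} → a ≢ u → Adj G a b → WalkAvoiding b c → WalkAvoiding a c

  _++_ : ∀ {a b c} → WalkAvoiding a b → WalkAvoiding b c → WalkAvoiding a c
  stop _       ++ W = W
  move a≢u e V ++ W = move a≢u e (V ++ W)

  head≢ : ∀ {a b} → WalkAvoiding a b → a ≢ u
  head≢ (stop a≢u)     = a≢u
  head≢ (move a≢u _ _) = a≢u

  reverse : ∀ {a b} → WalkAvoiding a b → WalkAvoiding b a
  reverse (stop a≢u)     = stop a≢u
  reverse (move a≢u e W) = reverse W ++ move (head≢ W) (Adj-sym G e) (stop a≢u)

  toWalk : ∀ {a b} → WalkAvoiding a b → Σ (Walk G a b) λ W → All (_≢ u) (verts W)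
  toWalk (stop {a} a≢u) = here a , a≢u ∷ []
  toWalk (move a≢u e W) = let W′ , W′≢u = toWalk W in step e W′ , a≢u ∷ W′≢u

  -- the vertex from which W first steps onto u (junk value u when W is empty)
  exit : ∀ {w} → Walk G w u → Fin n
  exit (here _) = u
  exit (step {u = a} {v = b} _ W) with b ≟ u
  ... | yes _ = a
  ... | no _  = exit W

  exit-spec : ∀ {w} (W : Walk G w u) → w ≢ u → WalkAvoiding w (exit W) × Adj G (exit W) u
  exit-spec (here _) w≢u = ⊥-elim (w≢u refl)
  exit-spec (step {v = b} wb W) w≢u with b ≟ u
  ... | yes refl = stop w≢u , wb
  ... | no b≢u   = let W′ , exit~u = exit-spec W b≢u in move w≢u wb W′ , exit~u

  acyclic⇒nbrs-unlinked : ¬ HasCycle G → ∀ {p q} → Adj G u p → Adj G u q → p ≢ q →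
    ¬ WalkAvoiding p q
  acyclic⇒nbrs-unlinked acyclic up uq p≢q W with toWalk W
  ... | W′ , W′≢u with walk⇒path (_≢ u) W′ W′≢u
  ...   | here _ , _ = p≢q refl
  ...   | step e P , P-distinct , P≢u = acyclic
    (u , _ , step up (step e P) , All.map ≢-sym P≢u ∷ P-distinct ,
     s≤s (s≤s (1≤length-verts P)) , Adj-sym G uq)

module Branches {n} (G : Graph n) (connected : Connected G) (acyclic : ¬ HasCycle G) (u : Fin n) where
  open Avoiding G u

  branch : Fin n → Fin n
  branch w = exit (connected w u)

  branch-avoiding : ∀ {w} → w ≢ u → WalkAvoiding w (branch w)
  branch-avoiding w≢u = proj₁ (exit-spec (connected _ u) w≢u)

  branch-nbr : ∀ {w} → w ≢ u → Adj G u (branch w)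
  branch-nbr w≢u = Adj-sym G (proj₂ (exit-spec (connected _ u) w≢u))

  branch-of-nbr : ∀ {p} → Adj G u p → branch p ≡ p
  branch-of-nbr up = decidable-stable (_ ≟ _) λ branch≢p →
    acyclic⇒nbrs-unlinked acyclic up (branch-nbr p≢u) (≢-sym branch≢p) (branch-avoiding p≢u)
    where p≢u = ≢-sym (Adj⇒≢ G up)

  branch-cong : ∀ {v w} → v ≢ u → w ≢ u → Adj G v w → branch v ≡ branch w
  branch-cong v≢u w≢u vw = decidable-stable (_ ≟ _) λ branch-v≢branch-w →
    acyclic⇒nbrs-unlinked acyclic (branch-nbr v≢u) (branch-nbr w≢u) branch-v≢branch-w
      (reverse (branch-avoiding v≢u) ++ move v≢u vw (branch-avoiding w≢u))

  InBranches : Fin n → Fin n → Pred (Fin n) 0ℓ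
  InBranches x y w = w ≢ u × (branch w ≡ x ⊎ branch w ≡ y)

  inBranches? : ∀ x y → Decidable (InBranches x y)
  inBranches? x y w = ¬? (w ≟ u) ×-dec (branch w ≟ x ⊎-dec branch w ≟ y)

  nbr-inBranches : ∀ {x y p} → Adj G u p → InBranches x y p → p ≡ x ⊎ p ≡ y
  nbr-inBranches up (_ , branch≡) = subst (λ b → b ≡ _ ⊎ b ≡ _) (branch-of-nbr up) branch≡

  no-third-in-closedNbhd : ∀ {F x y t} → IsMinimalFort G F → x ∈ F → y ∈ F → t ∈ F →
    x ≢ y → t ≢ x → t ≢ y → Adj G u x → Adj G u y → InClosedNbhd G u t → ⊥
  no-third-in-closedNbhd {F} {x} {y} {t} (fort , minimal) x∈F y∈F t∈F x≢y t≢x t≢y ux uy ut =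
    minimal F′ (proj₁ ∘ ∈-restrict⁻ P? , t , t∈F , t∉F′) F′-fort
    where
    P? = inBranches? x y
    F′ = restrict F P?

    nbrs⊆F : ∀ {p} → Adj G u p → InBranches x y p → p ∈ F
    nbrs⊆F up p∈P = [ (λ { refl → x∈F }) , (λ { refl → y∈F }) ] (nbr-inBranches up p∈P)

    P-closed : ∀ {v w} → InBranches x y v → w ≢ u → Adj G v w → InBranches x y w
    P-closed (v≢u , branch≡) w≢u vw =
      w≢u , subst (λ b → b ≡ x ⊎ b ≡ y) (branch-cong v≢u w≢u vw) branch≡

    F′-fort : IsFort G F′
    F′-fort = restrict-isFort G P? fort (λ (u≢u , _) → u≢u refl) P-closed nbrs⊆F ux uy x≢y
      (≢-sym (Adj⇒≢ G ux) , inj₁ (branch-of-nbr ux))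
      (≢-sym (Adj⇒≢ G uy) , inj₂ (branch-of-nbr uy))

    t∉P : InClosedNbhd G u t → ¬ InBranches x y t
    t∉P (inj₁ t≡u) (t≢u , _) = t≢u t≡u
    t∉P (inj₂ ut)  t∈P       = [ t≢x , t≢y ] (nbr-inBranches ut t∈P)

    t∉F′ : t ∉ F′
    t∉F′ = t∉P ut ∘ proj₂ ∘ ∈-restrict⁻ {F = F} P?

  no-three-in-closedNbhd : ∀ {F a b c} → IsMinimalFort G F → a ∈ F → b ∈ F → c ∈ F →
    a ≢ b → a ≢ c → b ≢ c →
    InClosedNbhd G u a → InClosedNbhd G u b → InClosedNbhd G u c → ⊥
  no-three-in-closedNbhd {a = a} {b} minimal a∈F b∈F c∈F a≢b a≢c b≢c ua ub uc with a ≟ u | b ≟ u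
  ... | yes a≡u | _ = no-third-in-closedNbhd minimal b∈F c∈F a∈F b≢c a≢b a≢c
    (InClosedNbhd⇒Adj G ub (a≢b ∘ trans a≡u ∘ sym))
    (InClosedNbhd⇒Adj G uc (a≢c ∘ trans a≡u ∘ sym)) ua
  ... | no a≢u | yes b≡u = no-third-in-closedNbhd minimal a∈F c∈F b∈F a≢c (≢-sym a≢b) b≢c
    (InClosedNbhd⇒Adj G ua a≢u)
    (InClosedNbhd⇒Adj G uc (b≢c ∘ trans b≡u ∘ sym)) ub
  ... | no a≢u | no b≢u = no-third-in-closedNbhd minimal a∈F b∈F c∈F a≢b (≢-sym a≢c) (≢-sym b≢c)
    (InClosedNbhd⇒Adj G ua a≢u)
    (InClosedNbhd⇒Adj G ub b≢u) uc

corollary8 : ∀ {n} (T : Graph n) (F : Subset n) → IsTree T → IsMinimalFort T F →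
    ¬ (Σ (Fin n) λ a → Σ (Fin n) λ b → Σ (Fin n) λ c → Σ (Fin n) λ u →
        a ∈ F × b ∈ F × c ∈ F × a ≢ b × a ≢ c × b ≢ c ×
        InClosedNbhd T u a × InClosedNbhd T u b × InClosedNbhd T u c)
corollary8 T F (_ , connected , acyclic) minimal
  (a , b , c , u , a∈F , b∈F , c∈F , a≢b , a≢c , b≢c , ua , ub , uc) =
  Branches.no-three-in-closedNbhd T connected acyclic u minimal
    a∈F b∈F c∈F a≢b a≢c b≢c ua ub uc
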